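{- For a positive integer $n$, let $\mathcal{G}_n$ be the set of all spiro hexagonal chains with $n$ hexagons. Then the average Wiener index $$W_{avr}(\mathcal{G}_n)=\frac{1}{|\mathcal{G}_n|}\sum_{G\in\mathcal{G}_n}W(G)$$ equals $\frac13(25n^3+60n^2-4n)$.
   Context: The Wiener index is $W(G)=\sum_{\{u,v\}\subseteq V(G)} d(u,v)$, with $d$ the shortest-path distance. A spiro hexagonal chain with $n$ hexagons is a union of hexagons (6-cycles) $H_0,\dots,H_{n-1}$ such that for $1\le k\le n-1$, $H_{k-1}$ and $H_k$ share exactly one vertex $c_k$, the $c_k$ are distinct, and $H_i,H_j$ are disjoint when $|i-j|\ge2$. For $n\ge3$ such a chain is described by its code $x_2x_3\cdots x_{n-1}$ over $\{O,M,P\}$, where $x_k=O,M,P$ according as $d(c_{k-1},c_k)=1,2,3$; a code and its reversal describe the same chain. The set $\mathcal{G}_n$ consists of the chains counted once each, i.e. codes of length $n-2$ modulo reversal (so $|\mathcal{G}_n|=\frac12(3^{n-2}+3^{\lfloor (n-1)/2\rfloor})$). -}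

module Defs where

open import Data.Nat using (ℕ; zero; suc; _+_; _*_; _∸_; _^_; _<ᵇ_; _≡ᵇ_)
open import Data.Bool using (Bool; true; false; _∧_; _∨_; if_then_else_)
open import Data.List using (List; []; _∷_; _++_; map; concatMap; filter; length; reverse; upTo)
open import Data.Bool.ListAction using (any)
open import Data.Nat.ListAction using (sum)
open import Data.Product using (_×_; _,_)
open import Relation.Nullary.Decidable using (does)
open import Relation.Binary.PropositionalEquality using (_≡_)

filterᵇ : {A : Set} → (A → Bool) → List A → List A
filterᵇ f [] = []
filterᵇ f (x ∷ xs) = if f x then x ∷ filterᵇ f xs else filterᵇ f xs

data Letter : Set where
  O M P : Letter

Code : Set
Code = List Letter

-- x = O, M, P  ⇔  d(c_{k-1}, c_k) = 1, 2, 3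
letterDist : Letter → ℕ
letterDist O = 1
letterDist M = 2
letterDist P = 3

-- Hexagon H_k has vertices 5k, 5k+1, ..., 5k+5, where 5k = c_k (the vertex
-- shared with H_{k-1}, for k ≥ 1) and 5(k+1) = c_{k+1} (shared with H_{k+1},
-- for k ≤ n-2).  Going around the 6-cycle of H_k starting from c_k,
-- c_{k+1} sits at cyclic position p ∈ {1,2,3}, so d(c_k, c_{k+1}) = p.
-- The other four vertices fill the remaining positions.
-- (For H_0 and H_{n-1} the position p is irrelevant up to isomorphism;
-- we fix p = 3.)  Total vertex set: 0, 1, ..., 5n.

hexCycle : ℕ → List ℕ
hexCycle 1 = 0 ∷ 5 ∷ 1 ∷ 2 ∷ 3 ∷ 4 ∷ []
hexCycle 2 = 0 ∷ 1 ∷ 5 ∷ 2 ∷ 3 ∷ 4 ∷ []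
hexCycle _ = 0 ∷ 1 ∷ 2 ∷ 5 ∷ 3 ∷ 4 ∷ []

cycleEdges : List ℕ → List (ℕ × ℕ)
cycleEdges [] = []
cycleEdges (a ∷ as) = go a (a ∷ as)
  where
  go : ℕ → List ℕ → List (ℕ × ℕ)
  go first [] = []
  go first (x ∷ []) = (x , first) ∷ []
  go first (x ∷ y ∷ ys) = (x , y) ∷ go first (y ∷ ys)

hexEdges : ℕ → ℕ → List (ℕ × ℕ)
hexEdges k p = cycleEdges (map (λ j → 5 * k + j) (hexCycle p))

-- cut positions p_0, ..., p_{n-1} of the n hexagons of the chain with code c
-- (for n ≥ 3, c = x_2 ⋯ x_{n-1}, and p_k = d(c_k, c_{k+1}) given by x_{k+1})
cutPositions : ℕ → Code → List ℕ
cutPositions zero _ = []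
cutPositions (suc zero) _ = 3 ∷ []
cutPositions (suc (suc _)) c = 3 ∷ map letterDist c ++ 3 ∷ []

edgesFrom : ℕ → List ℕ → List (ℕ × ℕ)
edgesFrom k [] = []
edgesFrom k (p ∷ ps) = hexEdges k p ++ edgesFrom (suc k) ps

-- a (finite, simple, undirected) graph on vertices 0 .. N-1 given by an edge list
record Graph : Set where
  field
    size  : ℕ
    edges : List (ℕ × ℕ)

open Graph public

-- the spiro hexagonal chain with n hexagons and code c (length n ∸ 2)
chain : ℕ → Code → Graph
chain n c = record { size = suc (5 * n) ; edges = edgesFrom 0 (cutPositions n c) }

vertices : Graph → List ℕ
vertices G = upTo (size G)

adjacent : Graph → ℕ → ℕ → Bool
adjacent G u v = any (λ e → test e) (edges G)
  where
  test : ℕ × ℕ → Bool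
  test (a , b) = ((a ≡ᵇ u) ∧ (b ≡ᵇ v)) ∨ ((a ≡ᵇ v) ∧ (b ≡ᵇ u))

neighbours : Graph → ℕ → List ℕ
neighbours G u = filterᵇ (adjacent G u) (vertices G)

ball : Graph → ℕ → ℕ → List ℕ
ball G zero u = u ∷ []
ball G (suc m) u = ball G m u ++ concatMap (neighbours G) (ball G m u)

elemᵇ : ℕ → List ℕ → Bool
elemᵇ v = any (λ w → w ≡ᵇ v)

searchDist : Graph → ℕ → ℕ → ℕ → ℕ → ℕ
searchDist G u v m zero = m
searchDist G u v m (suc fuel) =
  if elemᵇ v (ball G m u) then m else searchDist G u v (suc m) fuel

-- shortest-path distance d(u,v): the least m such that there is a walk of
-- length m from u to v (searched up to the number of vertices, which
-- suffices for connected graphs, e.g. all spiro chains)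
dist : Graph → ℕ → ℕ → ℕ
dist G u v = searchDist G u v 0 (size G)

wiener : Graph → ℕ
wiener G = sum (concatMap (λ u → map (λ v → dist G u v) (filterᵇ (λ v → u <ᵇ v) (vertices G))) (vertices G))

-- The set 𝒢_n: codes of length n ∸ 2 modulo reversal, one representative
-- per class (the lexicographically smaller of c and reverse c).

allCodes : ℕ → List Code
allCodes zero = [] ∷ []
allCodes (suc m) = concatMap (λ c → (O ∷ c) ∷ (M ∷ c) ∷ (P ∷ c) ∷ []) (allCodes m)

letterRank : Letter → ℕ
letterRank O = 0
letterRank M = 1
letterRank P = 2

lexLeq : Code → Code → Bool
lexLeq [] _ = true
lexLeq (_ ∷ _) [] = false
lexLeq (x ∷ xs) (y ∷ ys) =
  if letterRank x <ᵇ letterRank y then true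
  else if letterRank x ≡ᵇ letterRank y then lexLeq xs ys
  else false

chainCodes : ℕ → List Code
chainCodes n = filterᵇ (λ c → lexLeq c (reverse c)) (allCodes (n ∸ 2))

𝒢 : ℕ → List Graph
𝒢 n = map (chain n) (chainCodes n)

totalWiener : ℕ → ℕ
totalWiener n = sum (map wiener (𝒢 n))

module Submission where

-- A chain is given by the list ps of cut positions of its hexagons.  Its first
-- hexagon lives on the vertices 0..5, and the rest of the chain, translated
-- by 5, starts at the cut vertex 5.  The proof has three parts.
--
-- 1. Distances.  `dist` of Defs is breadth-first search, which returns any
--    distance labelling (zero at the source, changing by at most one along
--    edges, with a descent step at every other vertex).  The function
--    chainDist — the distance inside the first hexagon between the points where
--    u and v enter it, plus the distance in the rest of the chain — is such a
--    labelling; the facts needed about a single hexagon are checked by evaluation.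
-- 2. Wiener index.  Splitting the vertices into 0..4 and the shifted rest gives
--    W(p ∷ ps) = 27 + 45L + 5·T(ps) + W(ps) and T(p ∷ ps) = 9 + 5L·d(p) + T(ps),
--    T the transmission of vertex 0 and d(p) the distance between the cut
--    vertices of the first hexagon.  Hence W = base(n) + 25·Σⱼ j(n−1−j)·dⱼ.
-- 3. Averaging.  Mirroring a code (O ↔ P) replaces each dⱼ by 4 − dⱼ, so the
--    Wiener indices of a chain and its mirror image add up to a constant, and
--    mirroring permutes the chains of 𝒢ₙ up to reversal; so the average is
--    half of that constant.

open import Defs
open import Data.Nat
  using (ℕ; zero; suc; _+_; _*_; _∸_; _^_; _≤_; _<_; _≥_; z≤n; s≤s; _<ᵇ_; _≡ᵇ_; _≟_; _≤?_; _⊓_; ∣_-_∣)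
open import Data.Nat.Properties
open import Data.Nat.ListAction using (sum)
open import Data.Nat.ListAction.Properties using (sum-++)
open import Data.Nat.Tactic.RingSolver using (solve-∀)
open import Data.Bool using (Bool; true; false; T; if_then_else_; _∧_)
open import Data.Bool.Properties using (T-∧; T-∨)
open import Data.Bool.ListAction using (any)
open import Data.Unit using (tt)
open import Data.Empty using (⊥-elim)
open import Data.List using (List; []; _∷_; _++_; map; concatMap; length; reverse; replicate; upTo; applyUpTo)
open import Data.List.Properties
  using (map-++; map-∘; map-id; map-cong; map-upTo; map-concatMap; length-upTo; length-map; length-++;
         length-reverse; length-replicate; unfold-reverse; reverse-map; reverse-involutive)
open import Data.List.Membership.Propositional using (_∈_; find; lose)
open import Data.List.Membership.Propositional.Properties
  using (∈-++⁺ˡ; ∈-++⁺ʳ; ∈-++⁻; ∈-map⁺; ∈-map⁻; ∈-upTo⁺; ∈-upTo⁻; ∈-concatMap⁺; ∈-concatMap⁻)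
open import Data.List.Relation.Unary.Any using (Any; any?; here; there)
open import Data.List.Relation.Unary.All as All using (All; all?; lookup)
open import Data.List.Relation.Unary.AllPairs using (AllPairs; []; _∷_)
open import Data.List.Relation.Unary.AllPairs.Properties using (applyUpTo⁺₁)
open import Data.Product using (∃-syntax; _×_; _,_; proj₁; proj₂; map₁)
open import Data.Product.Properties using (≡-dec)
open import Data.Sum as Sum using (_⊎_; inj₁; inj₂)
open import Function using (Equivalence)
open import Relation.Nullary using (Dec; yes; no)
open import Relation.Nullary.Decidable using (toWitness; _×-dec_; _⊎-dec_)
open import Data.List.Membership.DecPropositional (≡-dec _≟_ _≟_) using (_∈?_)
open import Relation.Binary.PropositionalEquality

any-sound : ∀ {A : Set} (f : A → Bool) xs → T (any f xs) → ∃[ x ] (x ∈ xs × T (f x))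
any-sound f (x ∷ xs) t with f x in eq
... | true = x , here refl , subst T (sym eq) tt
... | false with any-sound f xs t
...   | y , y∈xs , fy = y , there y∈xs , fy

any-complete : ∀ {A : Set} (f : A → Bool) {x} xs → x ∈ xs → T (f x) → T (any f xs)
any-complete f (y ∷ xs) (here refl) fx with f y
... | true = tt
any-complete f (y ∷ xs) (there x∈xs) fx with f y
... | true = tt
... | false = any-complete f xs x∈xs fx

elem-sound : ∀ v xs → T (elemᵇ v xs) → v ∈ xs
elem-sound v xs t with any-sound (λ w → w ≡ᵇ v) xs t
... | w , w∈xs , w≡v rewrite ≡ᵇ⇒≡ w v w≡v = w∈xs

elem-complete : ∀ v xs → v ∈ xs → T (elemᵇ v xs)
elem-complete v xs v∈xs = any-complete (λ w → w ≡ᵇ v) xs v∈xs (≡⇒≡ᵇ v v refl)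

filter-sound : ∀ {A : Set} (f : A → Bool) {x} xs → x ∈ filterᵇ f xs → x ∈ xs × T (f x)
filter-sound f (y ∷ xs) x∈ with f y in eq
filter-sound f (y ∷ xs) (here refl) | true = here refl , subst T (sym eq) tt
filter-sound f (y ∷ xs) (there x∈) | true = map₁ there (filter-sound f xs x∈)
filter-sound f (y ∷ xs) x∈ | false = map₁ there (filter-sound f xs x∈)

filter-complete : ∀ {A : Set} (f : A → Bool) {x} xs → x ∈ xs → T (f x) → x ∈ filterᵇ f xs
filter-complete f (y ∷ xs) (here refl) fx with f y
... | true = here refl
filter-complete f (y ∷ xs) (there x∈) fx with f y
... | true = there (filter-complete f xs x∈ fx)
... | false = filter-complete f xs x∈ fx

Edge : List (ℕ × ℕ) → ℕ → ℕ → Set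
Edge es w v = (w , v) ∈ es ⊎ (v , w) ∈ es

pair-≡ᵇ : ∀ a b x y → T ((a ≡ᵇ x) ∧ (b ≡ᵇ y)) → (a , b) ≡ (x , y)
pair-≡ᵇ a b x y t = cong₂ _,_ (≡ᵇ⇒≡ a x (proj₁ (T-∧ .Equivalence.to t))) (≡ᵇ⇒≡ b y (proj₂ (T-∧ .Equivalence.to t)))

adjacent-sound : ∀ G w v → T (adjacent G w v) → Edge (edges G) w v
adjacent-sound G w v t with any-sound _ (edges G) t
... | (a , b) , e∈ , ab with T-∨ .Equivalence.to ab
... | inj₁ wv = inj₁ (subst (_∈ edges G) (pair-≡ᵇ a b w v wv) e∈)
... | inj₂ vw = inj₂ (subst (_∈ edges G) (pair-≡ᵇ a b v w vw) e∈)

adjacent-complete : ∀ G w v → Edge (edges G) w v → T (adjacent G w v)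
adjacent-complete G w v (inj₁ e∈) =
  any-complete _ (edges G) e∈ (T-∨ .Equivalence.from (inj₁ (T-∧ .Equivalence.from (≡⇒≡ᵇ w w refl , ≡⇒≡ᵇ v v refl))))
adjacent-complete G w v (inj₂ e∈) =
  any-complete _ (edges G) e∈ (T-∨ .Equivalence.from (inj₂ (T-∧ .Equivalence.from (≡⇒≡ᵇ v v refl , ≡⇒≡ᵇ w w refl))))

-- Such a D is the graph distance from u.
record DistanceLabelling (G : Graph) (u : ℕ) (D : ℕ → ℕ) : Set where
  field
    at-source : D u ≡ 0
    edge-step : ∀ w v → T (adjacent G w v) → D v ≤ suc (D w)
    descent   : ∀ v → v < size G → v ≢ u →
                ∃[ w ] (w < size G × T (adjacent G w v) × suc (D w) ≡ D v)
    bounded   : ∀ v → v < size G → D v < size G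

-- Breadth-first search, as performed by `dist` in Defs, computes any distance
-- labelling: the ball of radius m around u is exactly {v | D v ≤ m}.
module BreadthFirstSearch {G : Graph} {u : ℕ} {D : ℕ → ℕ} (L : DistanceLabelling G u D) where
  open DistanceLabelling L

  positive-away : ∀ v → v < size G → v ≢ u → D v ≢ 0
  positive-away v v<N v≢u Dv≡0 with descent v v<N v≢u
  ... | w , _ , _ , sucDw≡Dv = 0≢1+n (trans (sym Dv≡0) (sym sucDw≡Dv))

  ball-sound : ∀ m {x} → x ∈ ball G m u → D x ≤ m
  ball-sound zero (here refl) = ≤-reflexive at-source
  ball-sound (suc m) x∈ with ∈-++⁻ (ball G m u) x∈
  ... | inj₁ x∈ball = m≤n⇒m≤1+n (ball-sound m x∈ball)
  ... | inj₂ x∈next with find (∈-concatMap⁻ (neighbours G) {xs = ball G m u} x∈next)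
  ...   | w , w∈ball , x∈nbrs =
    ≤-trans (edge-step w _ (proj₂ (filter-sound (adjacent G w) (vertices G) x∈nbrs))) (s≤s (ball-sound m w∈ball))

  ball-complete : ∀ m v → v < size G → D v ≤ m → v ∈ ball G m u
  ball-complete zero v v<N Dv≤0 with v ≟ u
  ... | yes refl = here refl
  ... | no v≢u = ⊥-elim (positive-away v v<N v≢u (n≤0⇒n≡0 Dv≤0))
  ball-complete (suc m) v v<N Dv≤1+m with m≤n⇒m<n∨m≡n Dv≤1+m
  ... | inj₁ (s≤s Dv≤m) = ∈-++⁺ˡ (ball-complete m v v<N Dv≤m)
  ... | inj₂ Dv≡1+m with v ≟ u
  ...   | yes refl = ⊥-elim (0≢1+n (trans (sym at-source) Dv≡1+m))
  ...   | no v≢u with descent v v<N v≢u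
  ...     | w , w<N , w~v , sucDw≡Dv =
    ∈-++⁺ʳ (ball G m u) (∈-concatMap⁺ (neighbours G) (lose w∈ball v∈nbrs))
    where
    w∈ball : w ∈ ball G m u
    w∈ball = ball-complete m w w<N (≤-reflexive (suc-injective (trans sucDw≡Dv Dv≡1+m)))
    v∈nbrs : v ∈ neighbours G w
    v∈nbrs = filter-complete (adjacent G w) (vertices G) (∈-upTo⁺ v<N) w~v

  search : ∀ v → v < size G → ∀ fuel m → m ≤ D v → D v < m + fuel → searchDist G u v m fuel ≡ D v
  search v v<N zero m m≤Dv Dv<m+0 = ⊥-elim (<⇒≱ (subst (D v <_) (+-identityʳ m) Dv<m+0) m≤Dv)
  search v v<N (suc fuel) m m≤Dv Dv<m+fuel with elemᵇ v (ball G m u) in found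
  ... | true = ≤-antisym m≤Dv (ball-sound m (elem-sound v (ball G m u) (subst T (sym found) tt)))
  ... | false with m≤n⇒m<n∨m≡n m≤Dv
  ...   | inj₁ m<Dv = search v v<N fuel (suc m) m<Dv (subst (D v <_) (+-suc m fuel) Dv<m+fuel)
  ...   | inj₂ refl = ⊥-elim (subst T found (elem-complete v (ball G m u) (ball-complete m v v<N ≤-refl)))

  dist≡labelling : ∀ v → v < size G → dist G u v ≡ D v
  dist≡labelling v v<N = search v v<N (size G) 0 z≤n (bounded v v<N)

sumOver : {A : Set} → List A → (A → ℕ) → ℕ
sumOver xs f = sum (map f xs)

syntax sumOver xs (λ x → e) = ∑[ x ∈ xs ] e

∑-++ : ∀ {A : Set} xs ys (f : A → ℕ) → ∑[ x ∈ xs ++ ys ] f x ≡ ∑[ x ∈ xs ] f x + ∑[ x ∈ ys ] f x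
∑-++ xs ys f = trans (cong sum (map-++ f xs ys)) (sum-++ (map f xs) (map f ys))

∑-map : ∀ {A B : Set} (g : A → B) xs (f : B → ℕ) → ∑[ y ∈ map g xs ] f y ≡ ∑[ x ∈ xs ] f (g x)
∑-map g xs f = cong sum (sym (map-∘ xs))

∑-cong : ∀ {A : Set} xs {f g : A → ℕ} → (∀ {x} → x ∈ xs → f x ≡ g x) → ∑[ x ∈ xs ] f x ≡ ∑[ x ∈ xs ] g x
∑-cong [] f≡g = refl
∑-cong (x ∷ xs) f≡g = cong₂ _+_ (f≡g (here refl)) (∑-cong xs (λ x∈xs → f≡g (there x∈xs)))

∑-+ : ∀ {A : Set} xs (f g : A → ℕ) → ∑[ x ∈ xs ] (f x + g x) ≡ ∑[ x ∈ xs ] f x + ∑[ x ∈ xs ] g x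
∑-+ [] f g = refl
∑-+ (x ∷ xs) f g = trans (cong (f x + g x +_) (∑-+ xs f g)) (interchange (f x) (g x) _ _)
  where
  interchange : ∀ a b c d → (a + b) + (c + d) ≡ (a + c) + (b + d)
  interchange = solve-∀

∑-* : ∀ {A : Set} xs k (f : A → ℕ) → ∑[ x ∈ xs ] (k * f x) ≡ k * ∑[ x ∈ xs ] f x
∑-* [] k f = sym (*-zeroʳ k)
∑-* (x ∷ xs) k f = trans (cong (k * f x +_) (∑-* xs k f)) (sym (*-distribˡ-+ k (f x) _))

∑-const : ∀ {A : Set} (xs : List A) a → ∑[ x ∈ xs ] a ≡ length xs * a
∑-const [] a = refl
∑-const (x ∷ xs) a = cong (a +_) (∑-const xs a)

sum-concatMap : ∀ {A : Set} (g : A → List ℕ) xs → sum (concatMap g xs) ≡ ∑[ x ∈ xs ] sum (g x)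
sum-concatMap g [] = refl
sum-concatMap g (x ∷ xs) = trans (sum-++ (g x) (concatMap g xs)) (cong (sum (g x) +_) (sum-concatMap g xs))

∑-concatMap : ∀ {A B : Set} (g : A → List B) xs (f : B → ℕ) →
              ∑[ y ∈ concatMap g xs ] f y ≡ ∑[ x ∈ xs ] ∑[ y ∈ g x ] f y
∑-concatMap g xs f = trans (cong sum (map-concatMap f g xs)) (sum-concatMap (λ x → map f (g x)) xs)

∑-swap : ∀ {A B : Set} xs ys (f : A → B → ℕ) → ∑[ x ∈ xs ] ∑[ y ∈ ys ] f x y ≡ ∑[ y ∈ ys ] ∑[ x ∈ xs ] f x y
∑-swap [] ys f = sym (trans (∑-const ys 0) (*-zeroʳ (length ys)))
∑-swap (x ∷ xs) ys f = trans (cong (∑[ y ∈ ys ] f x y +_) (∑-swap xs ys f)) (sym (∑-+ ys (f x) _))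

pairSum : {A : Set} → (A → A → ℕ) → List A → ℕ
pairSum f [] = 0
pairSum f (x ∷ xs) = ∑[ y ∈ xs ] f x y + pairSum f xs

pairSum-++ : ∀ {A : Set} (f : A → A → ℕ) xs ys →
  pairSum f (xs ++ ys) ≡ pairSum f xs + ∑[ x ∈ xs ] ∑[ y ∈ ys ] f x y + pairSum f ys
pairSum-++ f [] ys = refl
pairSum-++ f (x ∷ xs) ys = begin
  ∑[ y ∈ xs ++ ys ] f x y + pairSum f (xs ++ ys)
    ≡⟨ cong₂ _+_ (∑-++ xs ys (f x)) (pairSum-++ f xs ys) ⟩
  (toXs + toYs) + (pairsXs + across + pairsYs)
    ≡⟨ regroup toXs toYs pairsXs across pairsYs ⟩
  (toXs + pairsXs) + (toYs + across) + pairsYs ∎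
  where
  open ≡-Reasoning
  toXs toYs across pairsXs pairsYs : ℕ
  toXs = ∑[ y ∈ xs ] f x y
  toYs = ∑[ y ∈ ys ] f x y
  across = ∑[ x′ ∈ xs ] ∑[ y ∈ ys ] f x′ y
  pairsXs = pairSum f xs
  pairsYs = pairSum f ys
  regroup : ∀ a b c d e → (a + b) + (c + d + e) ≡ (a + c) + (b + d) + e
  regroup = solve-∀

pairSum-map : ∀ {A B : Set} (g : A → B) (f : B → B → ℕ) xs → pairSum f (map g xs) ≡ pairSum (λ x y → f (g x) (g y)) xs
pairSum-map g f [] = refl
pairSum-map g f (x ∷ xs) = cong₂ _+_ (∑-map g xs (f (g x))) (pairSum-map g f xs)

pairSum-cong : ∀ {A : Set} xs {f g : A → A → ℕ} → (∀ {x y} → x ∈ xs → y ∈ xs → f x y ≡ g x y) →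
               pairSum f xs ≡ pairSum g xs
pairSum-cong [] f≡g = refl
pairSum-cong (x ∷ xs) f≡g =
  cong₂ _+_ (∑-cong xs (λ y∈xs → f≡g (here refl) (there y∈xs)))
            (pairSum-cong xs (λ x∈xs y∈xs → f≡g (there x∈xs) (there y∈xs)))

filter-all : ∀ {A : Set} (p : A → Bool) xs → All (λ x → T (p x)) xs → filterᵇ p xs ≡ xs
filter-all p [] All.[] = refl
filter-all p (x ∷ xs) (px All.∷ pxs) with p x
... | true = cong (x ∷_) (filter-all p xs pxs)

<ᵇ-false : ∀ {m n} → n ≤ m → (m <ᵇ n) ≡ false
<ᵇ-false {m} {n} n≤m with m <ᵇ n in eq
... | true = ⊥-elim (<⇒≱ (<ᵇ⇒< m n (subst T (sym eq) tt)) n≤m)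
... | false = refl

-- In a strictly increasing list the elements after x are exactly those greater
-- than x, so the double sum in the Wiener index of Defs is a pair sum.
pairSum-increasing : ∀ xs (f : ℕ → ℕ → ℕ) → AllPairs _<_ xs →
  ∑[ u ∈ xs ] ∑[ v ∈ filterᵇ (u <ᵇ_) xs ] f u v ≡ pairSum f xs
pairSum-increasing [] f [] = refl
pairSum-increasing (x ∷ xs) f (x<xs ∷ increasing) = cong₂ _+_ first rest
  where
  first : ∑[ v ∈ filterᵇ (x <ᵇ_) (x ∷ xs) ] f x v ≡ ∑[ v ∈ xs ] f x v
  first rewrite <ᵇ-false {x} ≤-refl =
    cong (λ ys → ∑[ v ∈ ys ] f x v) (filter-all (x <ᵇ_) xs (All.map <⇒<ᵇ x<xs))
  skip-x : ∀ {u} → u ∈ xs → filterᵇ (u <ᵇ_) (x ∷ xs) ≡ filterᵇ (u <ᵇ_) xs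
  skip-x u∈xs rewrite <ᵇ-false (<⇒≤ (lookup x<xs u∈xs)) = refl
  rest : ∑[ u ∈ xs ] ∑[ v ∈ filterᵇ (u <ᵇ_) (x ∷ xs) ] f u v ≡ pairSum f xs
  rest = trans (∑-cong xs (λ {u} u∈xs → cong (λ ys → ∑[ v ∈ ys ] f u v) (skip-x u∈xs)))
               (pairSum-increasing xs f increasing)

wiener≡pairSum : ∀ G → wiener G ≡ pairSum (dist G) (vertices G)
wiener≡pairSum G =
  trans (sum-concatMap (λ u → map (dist G u) (filterᵇ (u <ᵇ_) (vertices G))) (vertices G))
        (pairSum-increasing (vertices G) (dist G) (applyUpTo⁺₁ (λ i → i) (size G) (λ i<j _ → i<j)))

-- The hexagon with cut position p, on vertices 0..5: vertex 0 is shared with the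
-- previous hexagon and vertex 5 with the next one.
hexagonEdges : ℕ → List (ℕ × ℕ)
hexagonEdges p = cycleEdges (hexCycle p)

indexOf : ℕ → List ℕ → ℕ
indexOf a [] = 0
indexOf a (x ∷ xs) = if x ≡ᵇ a then 0 else suc (indexOf a xs)

cyclicDist : ℕ → ℕ → ℕ
cyclicDist x y = ∣ x - y ∣ ⊓ (6 ∸ ∣ x - y ∣)

hexDist : ℕ → ℕ → ℕ → ℕ
hexDist p a b = cyclicDist (indexOf a (hexCycle p)) (indexOf b (hexCycle p))

hexDist-self : ∀ p a → hexDist p a a ≡ 0
hexDist-self p a = cong (λ d → d ⊓ (6 ∸ d)) (∣n-n∣≡0 (indexOf a (hexCycle p)))

Close : ℕ → ℕ → Set
Close a b = a ≤ suc b × b ≤ suc a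

close-+ʳ : ∀ {a b} t → Close a b → Close (a + t) (b + t)
close-+ʳ t (a≤1+b , b≤1+a) = +-monoˡ-≤ t a≤1+b , +-monoˡ-≤ t b≤1+a

close-+ˡ : ∀ {a b} t → Close a b → Close (t + a) (t + b)
close-+ˡ {a} {b} t (a≤1+b , b≤1+a) =
  subst (t + a ≤_) (+-suc t b) (+-monoʳ-≤ t a≤1+b) , subst (t + b ≤_) (+-suc t a) (+-monoʳ-≤ t b≤1+a)

hexVertices : List ℕ
hexVertices = upTo 6

HexagonFacts : ℕ → Set
HexagonFacts p =
  All (λ e → proj₁ e ≤ 5 × proj₂ e ≤ 5) (hexagonEdges p) ×
  All (λ a → All (λ e → Close (hexDist p a (proj₁ e)) (hexDist p a (proj₂ e))) (hexagonEdges p)) hexVertices ×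
  All (λ a → All (λ b → a ≡ b ⊎ Any (λ w → Edge (hexagonEdges p) w b × suc (hexDist p a w) ≡ hexDist p a b) hexVertices)
                 hexVertices) hexVertices ×
  All (λ a → All (λ b → hexDist p a b ≤ 3) hexVertices) hexVertices

hexagonFacts? : ∀ p → Dec (HexagonFacts p)
hexagonFacts? p =
  all? (λ e → (proj₁ e ≤? 5) ×-dec (proj₂ e ≤? 5)) E ×-dec
  all? (λ a → all? (λ e → (hexDist p a (proj₁ e) ≤? suc (hexDist p a (proj₂ e))) ×-dec
                          (hexDist p a (proj₂ e) ≤? suc (hexDist p a (proj₁ e)))) E) hexVertices ×-dec
  all? (λ a → all? (λ b → (a ≟ b) ⊎-dec
         any? (λ w → (((w , b) ∈? E) ⊎-dec ((b , w) ∈? E)) ×-dec (suc (hexDist p a w) ≟ hexDist p a b)) hexVertices)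
       hexVertices) hexVertices ×-dec
  all? (λ a → all? (λ b → hexDist p a b ≤? 3) hexVertices) hexVertices
  where
  E : List (ℕ × ℕ)
  E = hexagonEdges p

-- HexagonFacts holds for every p: hexCycle p is the same for p = 0 and all
-- p ≥ 3, so checking p = 0, 1, 2 and a generic p ≥ 3 by evaluation suffices.
hexagonFacts : ∀ p → HexagonFacts p
hexagonFacts 0 = toWitness {a? = hexagonFacts? 0} tt
hexagonFacts 1 = toWitness {a? = hexagonFacts? 1} tt
hexagonFacts 2 = toWitness {a? = hexagonFacts? 2} tt
hexagonFacts (suc (suc (suc p))) = toWitness {a? = hexagonFacts? (suc (suc (suc p)))} tt

hexVertex : ∀ {a} → a ≤ 5 → a ∈ hexVertices
hexVertex a≤5 = ∈-upTo⁺ (s≤s a≤5)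

hex-edge-ends : ∀ p {x y} → (x , y) ∈ hexagonEdges p → x ≤ 5 × y ≤ 5
hex-edge-ends p e∈ = lookup (proj₁ (hexagonFacts p)) e∈

hex-close : ∀ p {a x y} → a ≤ 5 → (x , y) ∈ hexagonEdges p → Close (hexDist p a x) (hexDist p a y)
hex-close p a≤5 e∈ = lookup (lookup (proj₁ (proj₂ (hexagonFacts p))) (hexVertex a≤5)) e∈

hex-descent : ∀ p {a b} → a ≤ 5 → b ≤ 5 → a ≢ b →
  ∃[ w ] (w ≤ 5 × Edge (hexagonEdges p) w b × suc (hexDist p a w) ≡ hexDist p a b)
hex-descent p a≤5 b≤5 a≢b with lookup (lookup (proj₁ (proj₂ (proj₂ (hexagonFacts p)))) (hexVertex a≤5)) (hexVertex b≤5)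
... | inj₁ a≡b = ⊥-elim (a≢b a≡b)
... | inj₂ closer with find closer
...   | w , w∈ , edge , step = w , ≤-pred (∈-upTo⁻ w∈) , edge , step

hex-bounded : ∀ p {a b} → a ≤ 5 → b ≤ 5 → hexDist p a b ≤ 3
hex-bounded p a≤5 b≤5 = lookup (lookup (proj₂ (proj₂ (proj₂ (hexagonFacts p)))) (hexVertex a≤5)) (hexVertex b≤5)

shift : ℕ → ℕ × ℕ → ℕ × ℕ
shift d (x , y) = (d + x , d + y)

hexEdges-shift : ∀ k p → hexEdges k p ≡ map (shift (5 * k)) (hexagonEdges p)
hexEdges-shift k 0 = refl
hexEdges-shift k 1 = refl
hexEdges-shift k 2 = refl
hexEdges-shift k (suc (suc (suc p))) = refl

shift-suc : ∀ k e → shift (5 * suc k) e ≡ shift (5 * k) (shift 5 e)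
shift-suc k (x , y) = cong₂ _,_ (five-more k x) (five-more k y)
  where
  five-more : ∀ k z → 5 * suc k + z ≡ 5 * k + (5 + z)
  five-more = solve-∀

mutual
  edgesFrom-shift : ∀ k ps → edgesFrom k ps ≡ map (shift (5 * k)) (edgesFrom 0 ps)
  edgesFrom-shift k [] = refl
  edgesFrom-shift k (p ∷ ps) = begin
    hexEdges k p ++ edgesFrom (suc k) ps
      ≡⟨ cong₂ _++_ (hexEdges-shift k p) (edgesFrom-shift (suc k) ps) ⟩
    map (shift (5 * k)) (hexagonEdges p) ++ map (shift (5 * suc k)) (edgesFrom 0 ps)
      ≡⟨ cong (map (shift (5 * k)) (hexagonEdges p) ++_)
              (trans (map-cong (shift-suc k) (edgesFrom 0 ps)) (map-∘ (edgesFrom 0 ps))) ⟩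
    map (shift (5 * k)) (hexagonEdges p) ++ map (shift (5 * k)) (map (shift 5) (edgesFrom 0 ps))
      ≡⟨ sym (map-++ (shift (5 * k)) (hexagonEdges p) _) ⟩
    map (shift (5 * k)) (hexagonEdges p ++ map (shift 5) (edgesFrom 0 ps))
      ≡⟨ cong (map (shift (5 * k))) (sym (chainEdges-cons p ps)) ⟩
    map (shift (5 * k)) (edgesFrom 0 (p ∷ ps)) ∎
    where
    open ≡-Reasoning
  chainEdges-cons : ∀ p ps → edgesFrom 0 (p ∷ ps) ≡ hexagonEdges p ++ map (shift 5) (edgesFrom 0 ps)
  chainEdges-cons p ps =
    cong₂ _++_ (trans (hexEdges-shift 0 p) (trans (map-cong (λ _ → refl) (hexagonEdges p)) (map-id (hexagonEdges p))))
               (edgesFrom-shift 1 ps)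

chainEdge-cases : ∀ p ps {x y} → (x , y) ∈ edgesFrom 0 (p ∷ ps) →
  (x , y) ∈ hexagonEdges p ⊎ ∃[ e ] (e ∈ edgesFrom 0 ps × (x , y) ≡ shift 5 e)
chainEdge-cases p ps e∈ with ∈-++⁻ (hexagonEdges p) (subst (_ ∈_) (chainEdges-cons p ps) e∈)
... | inj₁ e∈first = inj₁ e∈first
... | inj₂ e∈rest = inj₂ (∈-map⁻ (shift 5) e∈rest)

first-edge : ∀ p ps {w v} → Edge (hexagonEdges p) w v → Edge (edgesFrom 0 (p ∷ ps)) w v
first-edge p ps e = Sum.map include include e
  where
  include : ∀ {e} → e ∈ hexagonEdges p → e ∈ edgesFrom 0 (p ∷ ps)
  include e∈ = subst (_ ∈_) (sym (chainEdges-cons p ps)) (∈-++⁺ˡ e∈)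

rest-edge : ∀ p ps {w v} → Edge (edgesFrom 0 ps) w v → Edge (edgesFrom 0 (p ∷ ps)) (5 + w) (5 + v)
rest-edge p ps e = Sum.map include include e
  where
  include : ∀ {e} → e ∈ edgesFrom 0 ps → shift 5 e ∈ edgesFrom 0 (p ∷ ps)
  include e∈ = subst (_ ∈_) (sym (chainEdges-cons p ps)) (∈-++⁺ʳ (hexagonEdges p) (∈-map⁺ (shift 5) e∈))

-- The vertex of the first hexagon through which a path from v enters it:
-- v itself for v ≤ 5, and the cut vertex 5 otherwise.
toFirst : ℕ → ℕ
toFirst v = v ⊓ 5

toFirst-≤5 : ∀ v → toFirst v ≤ 5
toFirst-≤5 v = m⊓n≤n v 5

toFirst-inner : ∀ {v} → v ≤ 5 → toFirst v ≡ v
toFirst-inner = m≤n⇒m⊓n≡m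

toFirst-outer : ∀ t → toFirst (5 + t) ≡ 5
toFirst-outer t = m≥n⇒m⊓n≡n (m≤m+n 5 t)

chainDist : List ℕ → ℕ → ℕ → ℕ
chainDist [] u v = 0
chainDist (p ∷ ps) u v = hexDist p (toFirst u) (toFirst v) + chainDist ps (u ∸ 5) (v ∸ 5)

chainDist-self : ∀ ps u → chainDist ps u u ≡ 0
chainDist-self [] u = refl
chainDist-self (p ∷ ps) u = cong₂ _+_ (hexDist-self p (toFirst u)) (chainDist-self ps (u ∸ 5))

chainDist-to-first : ∀ p ps u {v} → v ≤ 5 → chainDist (p ∷ ps) u v ≡ hexDist p (toFirst u) v + chainDist ps (u ∸ 5) 0
chainDist-to-first p ps u v≤5 =
  cong₂ (λ a b → hexDist p (toFirst u) a + chainDist ps (u ∸ 5) b) (toFirst-inner v≤5) (m≤n⇒m∸n≡0 v≤5)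

chainDist-to-rest : ∀ p ps u t → chainDist (p ∷ ps) u (5 + t) ≡ hexDist p (toFirst u) 5 + chainDist ps (u ∸ 5) t
chainDist-to-rest p ps u t = cong (λ a → hexDist p (toFirst u) a + chainDist ps (u ∸ 5) t) (toFirst-outer t)

chainDist-edge : ∀ ps u {x y} → (x , y) ∈ edgesFrom 0 ps → Close (chainDist ps u x) (chainDist ps u y)
chainDist-edge (p ∷ ps) u e∈ with chainEdge-cases p ps e∈
... | inj₁ e∈first
  with x≤5 , y≤5 ← hex-edge-ends p e∈first
  rewrite chainDist-to-first p ps u x≤5 | chainDist-to-first p ps u y≤5
  = close-+ʳ (chainDist ps (u ∸ 5) 0) (hex-close p (toFirst-≤5 u) e∈first)
... | inj₂ ((x′ , y′) , e∈rest , refl)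
  rewrite chainDist-to-rest p ps u x′ | chainDist-to-rest p ps u y′
  = close-+ˡ (hexDist p (toFirst u) 5) (chainDist-edge ps (u ∸ 5) e∈rest)

chainDist-bounded : ∀ ps u v → chainDist ps u v ≤ 3 * length ps
chainDist-bounded [] u v = z≤n
chainDist-bounded (p ∷ ps) u v =
  subst (chainDist (p ∷ ps) u v ≤_) (sym (*-suc 3 (length ps)))
        (+-mono-≤ (hex-bounded p (toFirst-≤5 u) (toFirst-≤5 v)) (chainDist-bounded ps (u ∸ 5) (v ∸ 5)))

five≤ : ∀ L → 5 ≤ 5 * suc L
five≤ L = subst (5 ≤_) (sym (*-suc 5 L)) (m≤m+n 5 (5 * L))

rest-bound : ∀ L {z} → 5 + z ≤ 5 * suc L → z ≤ 5 * L
rest-bound L {z} le = +-cancelˡ-≤ 5 z (5 * L) (subst (5 + z ≤_) (*-suc 5 L) le)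

Descent : List ℕ → ℕ → ℕ → Set
Descent ps u v = ∃[ w ] (w ≤ 5 * length ps × Edge (edgesFrom 0 ps) w v × suc (chainDist ps u w) ≡ chainDist ps u v)

descent-first : ∀ p ps u {v} → v ≤ 5 → toFirst u ≢ v → Descent (p ∷ ps) u v
descent-first p ps u {v} v≤5 u≢v
  with w , w≤5 , edge , closer ← hex-descent p (toFirst-≤5 u) v≤5 u≢v =
  w , ≤-trans w≤5 (five≤ (length ps)) , first-edge p ps edge , (begin
    suc (chainDist (p ∷ ps) u w)                           ≡⟨ cong suc (chainDist-to-first p ps u w≤5) ⟩
    suc (hexDist p (toFirst u) w) + chainDist ps (u ∸ 5) 0  ≡⟨ cong (_+ chainDist ps (u ∸ 5) 0) closer ⟩
    hexDist p (toFirst u) v + chainDist ps (u ∸ 5) 0        ≡⟨ sym (chainDist-to-first p ps u v≤5) ⟩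
    chainDist (p ∷ ps) u v ∎)
  where open ≡-Reasoning

descent-rest : ∀ p ps u t → Descent ps (u ∸ 5) t → Descent (p ∷ ps) u (5 + t)
descent-rest p ps u t (w , w≤ , edge , closer) =
  5 + w , subst (5 + w ≤_) (sym (*-suc 5 (length ps))) (+-monoʳ-≤ 5 w≤) , rest-edge p ps edge , (begin
    suc (chainDist (p ∷ ps) u (5 + w))                             ≡⟨ cong suc (chainDist-to-rest p ps u w) ⟩
    suc (hexDist p (toFirst u) 5 + chainDist ps (u ∸ 5) w)          ≡⟨ sym (+-suc _ _) ⟩
    hexDist p (toFirst u) 5 + suc (chainDist ps (u ∸ 5) w)          ≡⟨ cong (hexDist p (toFirst u) 5 +_) closer ⟩
    hexDist p (toFirst u) 5 + chainDist ps (u ∸ 5) t                ≡⟨ sym (chainDist-to-rest p ps u t) ⟩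
    chainDist (p ∷ ps) u (5 + t) ∎)
  where open ≡-Reasoning

data Place : ℕ → Set where
  inner : ∀ {v} → v < 5 → Place v
  outer : ∀ t → Place (5 + t)

place : ∀ v → Place v
place 0 = inner (s≤s z≤n)
place 1 = inner (s≤s (s≤s z≤n))
place 2 = inner (s≤s (s≤s (s≤s z≤n)))
place 3 = inner (s≤s (s≤s (s≤s (s≤s z≤n))))
place 4 = inner (s≤s (s≤s (s≤s (s≤s (s≤s z≤n)))))
place (suc (suc (suc (suc (suc t))))) = outer t

chainDist-descent : ∀ ps u v → u ≤ 5 * length ps → v ≤ 5 * length ps → u ≢ v → Descent ps u v
chainDist-descent [] u v u≤0 v≤0 u≢v = ⊥-elim (u≢v (trans (n≤0⇒n≡0 u≤0) (sym (n≤0⇒n≡0 v≤0))))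
chainDist-descent (p ∷ ps) u v u≤ v≤ u≢v with place u | place v
... | inner u<5 | inner v<5 =
  descent-first p ps u (<⇒≤ v<5) (subst (_≢ v) (sym (toFirst-inner (<⇒≤ u<5))) u≢v)
... | outer s | inner v<5 =
  descent-first p ps (5 + s) (<⇒≤ v<5) (λ 5≡v → <-irrefl (sym (trans (sym (toFirst-outer s)) 5≡v)) v<5)
... | outer s | outer t =
  descent-rest p ps (5 + s) t
    (chainDist-descent ps s t (rest-bound (length ps) u≤) (rest-bound (length ps) v≤) (λ s≡t → u≢v (cong (5 +_) s≡t)))
... | inner u<5 | outer t with t ≟ 0
...   | yes refl = descent-first p ps u ≤-refl (subst (_≢ 5) (sym (toFirst-inner (<⇒≤ u<5))) (<⇒≢ u<5))
...   | no t≢0 =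
  descent-rest p ps u t
    (chainDist-descent ps (u ∸ 5) t (subst (_≤ 5 * length ps) (sym (m≤n⇒m∸n≡0 (<⇒≤ u<5))) z≤n)
      (rest-bound (length ps) v≤)
      (λ u∸5≡t → t≢0 (trans (sym u∸5≡t) (m≤n⇒m∸n≡0 (<⇒≤ u<5)))))

chainGraph : List ℕ → Graph
chainGraph ps = record { size = suc (5 * length ps) ; edges = edgesFrom 0 ps }

chainDist-labelling : ∀ ps u → u ≤ 5 * length ps → DistanceLabelling (chainGraph ps) u (chainDist ps u)
chainDist-labelling ps u u≤ = record
  { at-source = chainDist-self ps u
  ; edge-step = edge-step
  ; descent = descent
  ; bounded = λ v _ → s≤s (≤-trans (chainDist-bounded ps u v) (*-monoˡ-≤ (length ps) 3≤5))
  }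
  where
  3≤5 : 3 ≤ 5
  3≤5 = s≤s (s≤s (s≤s z≤n))
  edge-step : ∀ w v → T (adjacent (chainGraph ps) w v) → chainDist ps u v ≤ suc (chainDist ps u w)
  edge-step w v adj with adjacent-sound (chainGraph ps) w v adj
  ... | inj₁ wv∈ = proj₂ (chainDist-edge ps u wv∈)
  ... | inj₂ vw∈ = proj₁ (chainDist-edge ps u vw∈)
  descent : ∀ v → v < suc (5 * length ps) → v ≢ u →
            ∃[ w ] (w < suc (5 * length ps) × T (adjacent (chainGraph ps) w v) × suc (chainDist ps u w) ≡ chainDist ps u v)
  descent v (s≤s v≤) v≢u with w , w≤ , edge , closer ← chainDist-descent ps u v u≤ v≤ (λ u≡v → v≢u (sym u≡v)) =
    w , s≤s w≤ , adjacent-complete (chainGraph ps) w v edge , closer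

dist-chainGraph : ∀ ps {u v} → u < suc (5 * length ps) → v < suc (5 * length ps) →
                  dist (chainGraph ps) u v ≡ chainDist ps u v
dist-chainGraph ps {u} {v} (s≤s u≤) v< =
  BreadthFirstSearch.dist≡labelling (chainDist-labelling ps u u≤) v v<

chainVertices : ℕ → List ℕ
chainVertices L = upTo (suc (5 * L))

applyUpTo-+ : ∀ {A : Set} (f : ℕ → A) m n → applyUpTo f (m + n) ≡ applyUpTo f m ++ applyUpTo (λ i → f (m + i)) n
applyUpTo-+ f zero n = refl
applyUpTo-+ f (suc m) n = cong (f 0 ∷_) (applyUpTo-+ (λ i → f (suc i)) m n)

chainVertices-suc : ∀ L → chainVertices (suc L) ≡ upTo 5 ++ map (5 +_) (chainVertices L)
chainVertices-suc L = begin
  upTo (suc (5 * suc L))         ≡⟨ cong (λ N → upTo (suc N)) (*-suc 5 L) ⟩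
  upTo (5 + suc (5 * L))         ≡⟨ applyUpTo-+ (λ i → i) 5 (suc (5 * L)) ⟩
  upTo 5 ++ applyUpTo (5 +_) (suc (5 * L)) ≡⟨ cong (upTo 5 ++_) (sym (map-upTo (5 +_) (suc (5 * L)))) ⟩
  upTo 5 ++ map (5 +_) (chainVertices L) ∎
  where open ≡-Reasoning

transmission : List ℕ → ℕ
transmission ps = ∑[ v ∈ chainVertices (length ps) ] chainDist ps 0 v

wienerSum : List ℕ → ℕ
wienerSum ps = pairSum (chainDist ps) (chainVertices (length ps))

wiener-chainGraph : ∀ ps → wiener (chainGraph ps) ≡ wienerSum ps
wiener-chainGraph ps =
  trans (wiener≡pairSum (chainGraph ps))
        (pairSum-cong (chainVertices (length ps)) (λ u∈ v∈ → dist-chainGraph ps (∈-upTo⁻ u∈) (∈-upTo⁻ v∈)))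

-- Sums over a single hexagon, by evaluation: the pairs among 0..4 contribute 18
-- (the Wiener index 27 of the hexagon less the transmission 9 of vertex 5), and
-- the transmissions of vertices 5 and 0 are 9.
hexagonSums : ∀ p → pairSum (hexDist p) (upTo 5) ≡ 18 × ∑[ x ∈ upTo 5 ] hexDist p x 5 ≡ 9
                  × ∑[ v ∈ upTo 5 ] hexDist p 0 v + hexDist p 0 5 ≡ 9
hexagonSums 0 = refl , refl , refl
hexagonSums 1 = refl , refl , refl
hexagonSums 2 = refl , refl , refl
hexagonSums (suc (suc (suc p))) = refl , refl , refl

below5 : ∀ {x} → x ∈ upTo 5 → x ≤ 5
below5 x∈ = <⇒≤ (∈-upTo⁻ x∈)

chainDist-inner : ∀ p ps {u v} → u ≤ 5 → v ≤ 5 → chainDist (p ∷ ps) u v ≡ hexDist p u v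
chainDist-inner p ps {u} {v} u≤5 v≤5 = begin
  chainDist (p ∷ ps) u v                                  ≡⟨ chainDist-to-first p ps u v≤5 ⟩
  hexDist p (toFirst u) v + chainDist ps (u ∸ 5) 0
    ≡⟨ cong₂ (λ a b → hexDist p a v + chainDist ps b 0) (toFirst-inner u≤5) (m≤n⇒m∸n≡0 u≤5) ⟩
  hexDist p u v + chainDist ps 0 0                        ≡⟨ cong (hexDist p u v +_) (chainDist-self ps 0) ⟩
  hexDist p u v + 0                                       ≡⟨ +-identityʳ _ ⟩
  hexDist p u v ∎
  where open ≡-Reasoning

-- Distances from a vertex x of the first hexagon to the rest of the chain pass through 5.
across-sum : ∀ p ps {x} → x ≤ 5 →
  ∑[ y ∈ map (5 +_) (chainVertices (length ps)) ] chainDist (p ∷ ps) x y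
    ≡ suc (5 * length ps) * hexDist p x 5 + transmission ps
across-sum p ps {x} x≤5 = begin
  ∑[ y ∈ map (5 +_) V ] chainDist (p ∷ ps) x y       ≡⟨ ∑-map (5 +_) V (chainDist (p ∷ ps) x) ⟩
  ∑[ t ∈ V ] chainDist (p ∷ ps) x (5 + t)             ≡⟨ ∑-cong V (λ {t} _ → via-cut t) ⟩
  ∑[ t ∈ V ] (hexDist p x 5 + chainDist ps 0 t)       ≡⟨ ∑-+ V (λ _ → hexDist p x 5) (chainDist ps 0) ⟩
  ∑[ t ∈ V ] hexDist p x 5 + transmission ps          ≡⟨ cong (_+ transmission ps) (∑-const V (hexDist p x 5)) ⟩
  length V * hexDist p x 5 + transmission ps
    ≡⟨ cong (λ l → l * hexDist p x 5 + transmission ps) (length-upTo (suc (5 * length ps))) ⟩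
  suc (5 * length ps) * hexDist p x 5 + transmission ps ∎
  where
  open ≡-Reasoning
  V : List ℕ
  V = chainVertices (length ps)
  via-cut : ∀ t → chainDist (p ∷ ps) x (5 + t) ≡ hexDist p x 5 + chainDist ps 0 t
  via-cut t = trans (chainDist-to-rest p ps x t)
                    (cong₂ (λ a b → hexDist p a 5 + chainDist ps b t) (toFirst-inner x≤5) (m≤n⇒m∸n≡0 x≤5))

transmission-cons : ∀ p ps → transmission (p ∷ ps) ≡ 9 + 5 * length ps * hexDist p 0 5 + transmission ps
transmission-cons p ps = begin
  ∑[ v ∈ chainVertices (suc L) ] chainDist (p ∷ ps) 0 v
    ≡⟨ cong (λ vs → ∑[ v ∈ vs ] chainDist (p ∷ ps) 0 v) (chainVertices-suc L) ⟩
  ∑[ v ∈ upTo 5 ++ map (5 +_) V ] chainDist (p ∷ ps) 0 v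
    ≡⟨ ∑-++ (upTo 5) (map (5 +_) V) (chainDist (p ∷ ps) 0) ⟩
  ∑[ v ∈ upTo 5 ] chainDist (p ∷ ps) 0 v + ∑[ v ∈ map (5 +_) V ] chainDist (p ∷ ps) 0 v
    ≡⟨ cong₂ _+_ (∑-cong (upTo 5) (λ v∈ → chainDist-inner p ps z≤n (below5 v∈))) (across-sum p ps z≤n) ⟩
  toInner + (suc (5 * L) * toCut + transmission ps)
    ≡⟨ regroup toInner toCut L (transmission ps) ⟩
  (toInner + toCut) + 5 * L * toCut + transmission ps
    ≡⟨ cong (λ s → s + 5 * L * toCut + transmission ps) (proj₂ (proj₂ (hexagonSums p))) ⟩
  9 + 5 * L * toCut + transmission ps ∎
  where
  open ≡-Reasoning
  L toInner toCut : ℕ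
  L = length ps
  toInner = ∑[ v ∈ upTo 5 ] hexDist p 0 v
  toCut = hexDist p 0 5
  V : List ℕ
  V = chainVertices L
  regroup : ∀ a q L t → a + (suc (5 * L) * q + t) ≡ (a + q) + 5 * L * q + t
  regroup = solve-∀

first-pairs : ∀ p ps → pairSum (chainDist (p ∷ ps)) (upTo 5) ≡ 18
first-pairs p ps =
  trans (pairSum-cong (upTo 5) (λ x∈ y∈ → chainDist-inner p ps (below5 x∈) (below5 y∈))) (proj₁ (hexagonSums p))

first-to-rest : ∀ p ps → ∑[ x ∈ upTo 5 ] ∑[ y ∈ map (5 +_) (chainVertices (length ps)) ] chainDist (p ∷ ps) x y
                          ≡ suc (5 * length ps) * 9 + 5 * transmission ps
first-to-rest p ps = begin
  ∑[ x ∈ upTo 5 ] ∑[ y ∈ map (5 +_) (chainVertices L) ] chainDist (p ∷ ps) x y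
    ≡⟨ ∑-cong (upTo 5) (λ x∈ → across-sum p ps (below5 x∈)) ⟩
  ∑[ x ∈ upTo 5 ] (suc (5 * L) * hexDist p x 5 + transmission ps)
    ≡⟨ ∑-+ (upTo 5) (λ x → suc (5 * L) * hexDist p x 5) (λ _ → transmission ps) ⟩
  ∑[ x ∈ upTo 5 ] (suc (5 * L) * hexDist p x 5) + 5 * transmission ps
    ≡⟨ cong (_+ 5 * transmission ps) (∑-* (upTo 5) (suc (5 * L)) (λ x → hexDist p x 5)) ⟩
  suc (5 * L) * ∑[ x ∈ upTo 5 ] hexDist p x 5 + 5 * transmission ps
    ≡⟨ cong (λ s → suc (5 * L) * s + 5 * transmission ps) (proj₁ (proj₂ (hexagonSums p))) ⟩
  suc (5 * L) * 9 + 5 * transmission ps ∎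
  where
  open ≡-Reasoning
  L : ℕ
  L = length ps

rest-pairs : ∀ p ps → pairSum (chainDist (p ∷ ps)) (map (5 +_) (chainVertices (length ps))) ≡ wienerSum ps
rest-pairs p ps =
  trans (pairSum-map (5 +_) (chainDist (p ∷ ps)) (chainVertices (length ps)))
        (pairSum-cong (chainVertices (length ps)) (λ {a} {b} _ _ → within-rest a b))
  where
  within-rest : ∀ a b → chainDist (p ∷ ps) (5 + a) (5 + b) ≡ chainDist ps a b
  within-rest a b = trans (chainDist-to-rest p ps (5 + a) b)
                          (cong (_+ chainDist ps a b) (trans (cong (λ x → hexDist p x 5) (toFirst-outer a)) (hexDist-self p 5)))

wienerSum-cons : ∀ p ps → wienerSum (p ∷ ps) ≡ 27 + 45 * length ps + 5 * transmission ps + wienerSum ps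
wienerSum-cons p ps = begin
  pairSum D (chainVertices (suc L))
    ≡⟨ cong (pairSum D) (chainVertices-suc L) ⟩
  pairSum D (upTo 5 ++ map (5 +_) V)
    ≡⟨ pairSum-++ D (upTo 5) (map (5 +_) V) ⟩
  pairSum D (upTo 5) + ∑[ x ∈ upTo 5 ] ∑[ y ∈ map (5 +_) V ] D x y + pairSum D (map (5 +_) V)
    ≡⟨ cong₂ _+_ (cong₂ _+_ (first-pairs p ps) (first-to-rest p ps)) (rest-pairs p ps) ⟩
  18 + (suc (5 * L) * 9 + 5 * transmission ps) + wienerSum ps
    ≡⟨ regroup L (transmission ps) (wienerSum ps) ⟩
  27 + 45 * L + 5 * transmission ps + wienerSum ps ∎
  where
  open ≡-Reasoning
  L : ℕ
  L = length ps
  V : List ℕ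
  V = chainVertices L
  D : ℕ → ℕ → ℕ
  D = chainDist (p ∷ ps)
  regroup : ∀ L t w → 18 + (suc (5 * L) * 9 + 5 * t) + w ≡ 27 + 45 * L + 5 * t + w
  regroup = solve-∀

cutDist : ℕ → ℕ
cutDist p = hexDist p 0 5

-- For the cut positions ps = p₀ … p_{n-1}:
--   tailWeight a ps   = Σⱼ (a + n-1-j) · cutDist pⱼ,
--   pairWeight b a ps = Σⱼ (b + j)(a + n-1-j) · cutDist pⱼ,
-- i.e. each cut distance weighted by the numbers of hexagons after it (offset by a)
-- and before it (offset by b).
tailWeight : ℕ → List ℕ → ℕ
tailWeight a [] = 0
tailWeight a (p ∷ ps) = (a + length ps) * cutDist p + tailWeight a ps

pairWeight : ℕ → ℕ → List ℕ → ℕ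
pairWeight b a [] = 0
pairWeight b a (p ∷ ps) = b * (a + length ps) * cutDist p + pairWeight (suc b) a ps

pairWeight-suc : ∀ b a ps → pairWeight (suc b) a ps ≡ pairWeight b a ps + tailWeight a ps
pairWeight-suc b a [] = refl
pairWeight-suc b a (p ∷ ps) =
  trans (cong (suc b * (a + length ps) * cutDist p +_) (pairWeight-suc (suc b) a ps))
        (regroup b (a + length ps) (cutDist p) (pairWeight (suc b) a ps) (tailWeight a ps))
  where
  regroup : ∀ b x q k t → suc b * x * q + (k + t) ≡ b * x * q + k + (x * q + t)
  regroup = solve-∀

baseWiener : ℕ → ℕ
baseWiener zero = 0
baseWiener (suc L) = 27 + 90 * L + baseWiener L

baseWiener-closed : ∀ L → baseWiener L + 45 * L ≡ 27 * L + 45 * L * L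
baseWiener-closed zero = refl
baseWiener-closed (suc L) = begin
  27 + 90 * L + baseWiener L + 45 * suc L      ≡⟨ regroup L (baseWiener L) ⟩
  72 + 90 * L + (baseWiener L + 45 * L)        ≡⟨ cong (72 + 90 * L +_) (baseWiener-closed L) ⟩
  72 + 90 * L + (27 * L + 45 * L * L)          ≡⟨ expand L ⟩
  27 * suc L + 45 * suc L * suc L ∎
  where
  open ≡-Reasoning
  regroup : ∀ L b → 27 + 90 * L + b + 45 * suc L ≡ 72 + 90 * L + (b + 45 * L)
  regroup = solve-∀
  expand : ∀ L → 72 + 90 * L + (27 * L + 45 * L * L) ≡ 27 * suc L + 45 * suc L * suc L
  expand = solve-∀

transmission-closed : ∀ ps → transmission ps ≡ 9 * length ps + 5 * tailWeight 0 ps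
transmission-closed [] = refl
transmission-closed (p ∷ ps) = begin
  transmission (p ∷ ps)                                 ≡⟨ transmission-cons p ps ⟩
  9 + 5 * L * cutDist p + transmission ps               ≡⟨ cong (9 + 5 * L * cutDist p +_) (transmission-closed ps) ⟩
  9 + 5 * L * cutDist p + (9 * L + 5 * tailWeight 0 ps) ≡⟨ regroup L (cutDist p) (tailWeight 0 ps) ⟩
  9 * suc L + 5 * (L * cutDist p + tailWeight 0 ps) ∎
  where
  open ≡-Reasoning
  L : ℕ
  L = length ps
  regroup : ∀ L q t → 9 + 5 * L * q + (9 * L + 5 * t) ≡ 9 * suc L + 5 * (L * q + t)
  regroup = solve-∀

wienerSum-closed : ∀ ps → wienerSum ps ≡ baseWiener (length ps) + 25 * pairWeight 0 0 ps
wienerSum-closed [] = refl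
wienerSum-closed (p ∷ ps) = begin
  wienerSum (p ∷ ps)
    ≡⟨ wienerSum-cons p ps ⟩
  27 + 45 * L + 5 * transmission ps + wienerSum ps
    ≡⟨ cong₂ (λ t w → 27 + 45 * L + 5 * t + w) (transmission-closed ps) (wienerSum-closed ps) ⟩
  27 + 45 * L + 5 * (9 * L + 5 * tailWeight 0 ps) + (baseWiener L + 25 * pairWeight 0 0 ps)
    ≡⟨ regroup L (tailWeight 0 ps) (baseWiener L) (pairWeight 0 0 ps) ⟩
  27 + 90 * L + baseWiener L + 25 * (pairWeight 0 0 ps + tailWeight 0 ps)
    ≡⟨ cong (λ k → 27 + 90 * L + baseWiener L + 25 * k) (sym (pairWeight-suc 0 0 ps)) ⟩
  27 + 90 * L + baseWiener L + 25 * pairWeight 1 0 ps ∎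
  where
  open ≡-Reasoning
  L : ℕ
  L = length ps
  regroup : ∀ L t b k → 27 + 45 * L + 5 * (9 * L + 5 * t) + (b + 25 * k) ≡ 27 + 90 * L + b + 25 * (k + t)
  regroup = solve-∀

pairWeight-snoc : ∀ b a ps q → pairWeight b a (ps ++ q ∷ []) ≡ pairWeight b (suc a) ps + (b + length ps) * a * cutDist q
pairWeight-snoc b a [] q = regroup b a (cutDist q)
  where
  regroup : ∀ b a y → b * (a + 0) * y + 0 ≡ 0 + (b + 0) * a * y
  regroup = solve-∀
pairWeight-snoc b a (p ∷ ps) q =
  trans (cong₂ (λ l k → b * (a + l) * cutDist p + k) (length-++ ps) (pairWeight-snoc (suc b) a ps q))
        (regroup b a (length ps) (cutDist p) (cutDist q) (pairWeight (suc b) (suc a) ps))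
  where
  regroup : ∀ b a L x y k → b * (a + (L + 1)) * x + (k + (suc b + L) * a * y) ≡ b * (suc a + L) * x + k + (b + suc L) * a * y
  regroup = solve-∀

pairWeight-reverse : ∀ b a ps → pairWeight b a (reverse ps) ≡ pairWeight a b ps
pairWeight-reverse b a [] = refl
pairWeight-reverse b a (p ∷ ps) = begin
  pairWeight b a (reverse (p ∷ ps))
    ≡⟨ cong (pairWeight b a) (unfold-reverse p ps) ⟩
  pairWeight b a (reverse ps ++ p ∷ [])
    ≡⟨ pairWeight-snoc b a (reverse ps) p ⟩
  pairWeight b (suc a) (reverse ps) + (b + length (reverse ps)) * a * cutDist p
    ≡⟨ cong₂ (λ k l → k + (b + l) * a * cutDist p) (pairWeight-reverse b (suc a) ps) (length-reverse ps) ⟩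
  pairWeight (suc a) b ps + (b + length ps) * a * cutDist p
    ≡⟨ regroup a b (length ps) (cutDist p) (pairWeight (suc a) b ps) ⟩
  a * (b + length ps) * cutDist p + pairWeight (suc a) b ps ∎
  where
  open ≡-Reasoning
  regroup : ∀ a b L x k → k + (b + L) * a * x ≡ a * (b + L) * x + k
  regroup = solve-∀

pairWeight-complement : ∀ {X : Set} (f g : X → ℕ) s → (∀ x → cutDist (f x) + cutDist (g x) ≡ s) →
  ∀ b a xs → pairWeight b a (map f xs) + pairWeight b a (map g xs) ≡ s * pairWeight b a (replicate (length xs) 1)
pairWeight-complement f g s sum≡s b a [] = sym (*-zeroʳ s)
pairWeight-complement f g s sum≡s b a (x ∷ xs)
  rewrite length-map f xs | length-map g xs | length-replicate (length xs) {1} = begin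
    y * cutDist (f x) + pairWeight (suc b) a (map f xs) + (y * cutDist (g x) + pairWeight (suc b) a (map g xs))
      ≡⟨ regroup y (cutDist (f x)) (cutDist (g x)) (pairWeight (suc b) a (map f xs)) (pairWeight (suc b) a (map g xs)) ⟩
    y * (cutDist (f x) + cutDist (g x)) + (pairWeight (suc b) a (map f xs) + pairWeight (suc b) a (map g xs))
      ≡⟨ cong₂ (λ t k → y * t + k) (sum≡s x) (pairWeight-complement f g s sum≡s (suc b) a xs) ⟩
    y * s + s * pairWeight (suc b) a (replicate (length xs) 1)
      ≡⟨ factor y s (pairWeight (suc b) a (replicate (length xs) 1)) ⟩
    s * (y * 1 + pairWeight (suc b) a (replicate (length xs) 1)) ∎
  where
  open ≡-Reasoning
  y : ℕ
  y = b * (a + length xs)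
  regroup : ∀ y u v k l → y * u + k + (y * v + l) ≡ y * (u + v) + (k + l)
  regroup = solve-∀
  factor : ∀ y s k → y * s + s * k ≡ s * (y * 1 + k)
  factor = solve-∀

tailWeight-ones : ∀ m → 2 * tailWeight 1 (replicate m 1) ≡ m * suc m
tailWeight-ones zero = refl
tailWeight-ones (suc m) rewrite length-replicate m {1} = begin
  2 * ((1 + m) * 1 + t)      ≡⟨ regroup m t ⟩
  2 * suc m + 2 * t          ≡⟨ cong (2 * suc m +_) (tailWeight-ones m) ⟩
  2 * suc m + m * suc m      ≡⟨ expand m ⟩
  suc m * suc (suc m) ∎
  where
  open ≡-Reasoning
  t : ℕ
  t = tailWeight 1 (replicate m 1)
  regroup : ∀ m t → 2 * ((1 + m) * 1 + t) ≡ 2 * suc m + 2 * t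
  regroup = solve-∀
  expand : ∀ m → 2 * suc m + m * suc m ≡ suc m * suc (suc m)
  expand = solve-∀

pairWeight-ones : ∀ m → 6 * pairWeight 1 1 (replicate m 1) ≡ m * suc m * suc (suc m)
pairWeight-ones zero = refl
pairWeight-ones (suc m) rewrite length-replicate m {1} | pairWeight-suc 1 1 (replicate m 1) = begin
  6 * (1 * (1 + m) * 1 + (k + t))        ≡⟨ regroup m k t ⟩
  6 * suc m + 6 * k + 3 * (2 * t)        ≡⟨ cong₂ (λ x y → 6 * suc m + x + 3 * y) (pairWeight-ones m) (tailWeight-ones m) ⟩
  6 * suc m + m * suc m * suc (suc m) + 3 * (m * suc m) ≡⟨ expand m ⟩
  suc m * suc (suc m) * suc (suc (suc m)) ∎
  where
  open ≡-Reasoning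
  k t : ℕ
  k = pairWeight 1 1 (replicate m 1)
  t = tailWeight 1 (replicate m 1)
  regroup : ∀ m k t → 6 * (1 * (1 + m) * 1 + (k + t)) ≡ 6 * suc m + 6 * k + 3 * (2 * t)
  regroup = solve-∀
  expand : ∀ m → 6 * suc m + m * suc m * suc (suc m) + 3 * (m * suc m) ≡ suc m * suc (suc m) * suc (suc (suc m))
  expand = solve-∀

chainWiener : ℕ → Code → ℕ
chainWiener n c = baseWiener n + 25 * pairWeight 1 1 (map letterDist c)

cutPositions-length : ∀ m c → length c ≡ m → length (cutPositions (2 + m) c) ≡ 2 + m
cutPositions-length m c len≡m =
  cong suc (trans (length-++ (map letterDist c)) (trans (+-comm _ 1) (cong suc (trans (length-map letterDist c) len≡m))))

-- The first and last cut positions carry weight 0.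
pairWeight-cutPositions : ∀ m c → pairWeight 0 0 (cutPositions (2 + m) c) ≡ pairWeight 1 1 (map letterDist c)
pairWeight-cutPositions m c = begin
  pairWeight 1 0 (map letterDist c ++ 3 ∷ [])
    ≡⟨ pairWeight-snoc 1 0 (map letterDist c) 3 ⟩
  pairWeight 1 1 (map letterDist c) + (1 + length (map letterDist c)) * 0 * 3
    ≡⟨ cong (pairWeight 1 1 (map letterDist c) +_) (cong (_* 3) (*-zeroʳ (1 + length (map letterDist c)))) ⟩
  pairWeight 1 1 (map letterDist c) + 0
    ≡⟨ +-identityʳ _ ⟩
  pairWeight 1 1 (map letterDist c) ∎
  where open ≡-Reasoning

wiener-chain : ∀ m c → length c ≡ m → wiener (chain (2 + m) c) ≡ chainWiener (2 + m) c
wiener-chain m c len≡m = begin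
  wiener (chain (2 + m) c)
    ≡⟨ cong (λ N → wiener (record { size = suc (5 * N) ; edges = edgesFrom 0 ps })) (sym (cutPositions-length m c len≡m)) ⟩
  wiener (chainGraph ps)
    ≡⟨ wiener-chainGraph ps ⟩
  wienerSum ps
    ≡⟨ wienerSum-closed ps ⟩
  baseWiener (length ps) + 25 * pairWeight 0 0 ps
    ≡⟨ cong₂ (λ L k → baseWiener L + 25 * k) (cutPositions-length m c len≡m) (pairWeight-cutPositions m c) ⟩
  chainWiener (2 + m) c ∎
  where
  open ≡-Reasoning
  ps : List ℕ
  ps = cutPositions (2 + m) c

wiener-hexagon : ∀ c → wiener (chain 1 c) ≡ 27
wiener-hexagon c = trans (wiener-chainGraph (3 ∷ [])) (wienerSum-closed (3 ∷ []))

chainWiener-reverse : ∀ n c → chainWiener n (reverse c) ≡ chainWiener n c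
chainWiener-reverse n c =
  cong (λ k → baseWiener n + 25 * k) (trans (cong (pairWeight 1 1) (reverse-map letterDist c)) (pairWeight-reverse 1 1 (map letterDist c)))

-- The mirror image of a letter: O ↔ P.  Mirroring a code replaces each cut
-- distance d by 4 - d.
mirror : Letter → Letter
mirror O = P
mirror M = M
mirror P = O

-- 3 · W_avr(𝒢ₙ) for n = m + 2, as a polynomial in m.
threeAverage : ℕ → ℕ
threeAverage m = 25 * m * m * m + 210 * m * m + 536 * m + 432

cubic≡threeAverage : ∀ m → 25 * (2 + m) ^ 3 + 60 * (2 + m) ^ 2 ∸ 4 * (2 + m) ≡ threeAverage m
cubic≡threeAverage m = trans (cong (_∸ 4 * (2 + m)) (sym (expand m))) (m+n∸n≡m (threeAverage m) (4 * (2 + m)))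
  where
  -- (2 + m) ^ k unfolds to a product of k factors
  expand : ∀ m → 25 * m * m * m + 210 * m * m + 536 * m + 432 + 4 * (2 + m)
               ≡ 25 * ((2 + m) * ((2 + m) * ((2 + m) * 1))) + 60 * ((2 + m) * ((2 + m) * 1))
  expand = solve-∀

chainWiener-mirror : ∀ m c → length c ≡ m →
  3 * chainWiener (2 + m) c + 3 * chainWiener (2 + m) (map mirror c) ≡ 2 * threeAverage m
chainWiener-mirror m c len≡m = +-cancelʳ-≡ (270 * n) _ _ (begin
  3 * (b + 25 * k) + 3 * (b + 25 * k′) + 270 * n   ≡⟨ regroup b k k′ n ⟩
  6 * (b + 45 * n) + 75 * (k′ + k)                ≡⟨ cong₂ (λ x y → 6 * x + 75 * y) (baseWiener-closed n) complement ⟩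
  6 * (27 * n + 45 * n * n) + 75 * (4 * ones)      ≡⟨ cong (6 * (27 * n + 45 * n * n) +_) (regroup′ ones) ⟩
  6 * (27 * n + 45 * n * n) + 50 * (6 * ones)      ≡⟨ cong (λ x → 6 * (27 * n + 45 * n * n) + 50 * x) ones-value ⟩
  6 * (27 * n + 45 * n * n) + 50 * (m * suc m * suc (suc m)) ≡⟨ expand m ⟩
  2 * threeAverage m + 270 * n ∎)
  where
  open ≡-Reasoning
  n b k k′ ones : ℕ
  n = 2 + m
  b = baseWiener n
  k = pairWeight 1 1 (map letterDist c)
  k′ = pairWeight 1 1 (map letterDist (map mirror c))
  ones = pairWeight 1 1 (replicate (length c) 1)
  complement : k′ + k ≡ 4 * ones
  complement = trans (cong (λ ds → pairWeight 1 1 ds + k) (sym (map-∘ c)))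
                     (pairWeight-complement (λ x → letterDist (mirror x)) letterDist 4 adds-to-4 1 1 c)
    where
    adds-to-4 : ∀ x → cutDist (letterDist (mirror x)) + cutDist (letterDist x) ≡ 4
    adds-to-4 O = refl
    adds-to-4 M = refl
    adds-to-4 P = refl
  ones-value : 6 * ones ≡ m * suc m * suc (suc m)
  ones-value = trans (cong (λ l → 6 * pairWeight 1 1 (replicate l 1)) len≡m) (pairWeight-ones m)
  regroup : ∀ b k k′ n → 3 * (b + 25 * k) + 3 * (b + 25 * k′) + 270 * n ≡ 6 * (b + 45 * n) + 75 * (k′ + k)
  regroup = solve-∀
  regroup′ : ∀ x → 75 * (4 * x) ≡ 50 * (6 * x)
  regroup′ = solve-∀
  expand : ∀ m → 6 * (27 * (2 + m) + 45 * (2 + m) * (2 + m)) + 50 * (m * suc m * suc (suc m))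
                 ≡ 2 * (25 * m * m * m + 210 * m * m + 536 * m + 432) + 270 * (2 + m)
  expand = solve-∀

letters : List Letter
letters = O ∷ M ∷ P ∷ []

∑-allCodes-cons : ∀ m (F : Code → ℕ) → ∑[ c ∈ allCodes (suc m) ] F c ≡ ∑[ c ∈ allCodes m ] ∑[ x ∈ letters ] F (x ∷ c)
∑-allCodes-cons m F = ∑-concatMap (λ c → (O ∷ c) ∷ (M ∷ c) ∷ (P ∷ c) ∷ []) (allCodes m) F

∑-allCodes-snoc : ∀ m (F : Code → ℕ) →
  ∑[ c ∈ allCodes (suc m) ] F c ≡ ∑[ c ∈ allCodes m ] ∑[ x ∈ letters ] F (c ++ x ∷ [])
∑-allCodes-snoc zero F = sym (+-identityʳ _)
∑-allCodes-snoc (suc m) F = begin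
  ∑[ c ∈ allCodes (suc (suc m)) ] F c
    ≡⟨ ∑-allCodes-cons (suc m) F ⟩
  ∑[ c ∈ allCodes (suc m) ] ∑[ x ∈ letters ] F (x ∷ c)
    ≡⟨ ∑-allCodes-snoc m (λ c → ∑[ x ∈ letters ] F (x ∷ c)) ⟩
  ∑[ d ∈ allCodes m ] ∑[ y ∈ letters ] ∑[ x ∈ letters ] F (x ∷ d ++ y ∷ [])
    ≡⟨ ∑-cong (allCodes m) (λ {d} _ → ∑-swap letters letters (λ y x → F (x ∷ d ++ y ∷ []))) ⟩
  ∑[ d ∈ allCodes m ] ∑[ x ∈ letters ] ∑[ y ∈ letters ] F (x ∷ d ++ y ∷ [])
    ≡⟨ sym (∑-allCodes-cons m (λ c → ∑[ y ∈ letters ] F (c ++ y ∷ []))) ⟩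
  ∑[ c ∈ allCodes (suc m) ] ∑[ y ∈ letters ] F (c ++ y ∷ []) ∎
  where open ≡-Reasoning

∑-allCodes-mirror : ∀ m (F : Code → ℕ) → ∑[ c ∈ allCodes m ] F (map mirror c) ≡ ∑[ c ∈ allCodes m ] F c
∑-allCodes-mirror zero F = refl
∑-allCodes-mirror (suc m) F = begin
  ∑[ c ∈ allCodes (suc m) ] F (map mirror c)
    ≡⟨ ∑-allCodes-cons m (λ c → F (map mirror c)) ⟩
  ∑[ c ∈ allCodes m ] ∑[ x ∈ letters ] F (mirror x ∷ map mirror c)
    ≡⟨ ∑-allCodes-mirror m (λ d → ∑[ x ∈ letters ] F (mirror x ∷ d)) ⟩
  ∑[ d ∈ allCodes m ] ∑[ x ∈ letters ] F (mirror x ∷ d)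
    ≡⟨ ∑-cong (allCodes m) (λ {d} _ → swap-ends (F (P ∷ d)) (F (M ∷ d)) (F (O ∷ d))) ⟩
  ∑[ d ∈ allCodes m ] ∑[ x ∈ letters ] F (x ∷ d)
    ≡⟨ sym (∑-allCodes-cons m F) ⟩
  ∑[ c ∈ allCodes (suc m) ] F c ∎
  where
  open ≡-Reasoning
  swap-ends : ∀ a b c → a + (b + (c + 0)) ≡ c + (b + (a + 0))
  swap-ends = solve-∀

∑-allCodes-reverse : ∀ m (F : Code → ℕ) → ∑[ c ∈ allCodes m ] F (reverse c) ≡ ∑[ c ∈ allCodes m ] F c
∑-allCodes-reverse zero F = refl
∑-allCodes-reverse (suc m) F = begin
  ∑[ c ∈ allCodes (suc m) ] F (reverse c)
    ≡⟨ ∑-allCodes-cons m (λ c → F (reverse c)) ⟩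
  ∑[ c ∈ allCodes m ] ∑[ x ∈ letters ] F (reverse (x ∷ c))
    ≡⟨ ∑-cong (allCodes m) (λ {c} _ → ∑-cong letters (λ {x} _ → cong F (unfold-reverse x c))) ⟩
  ∑[ c ∈ allCodes m ] ∑[ x ∈ letters ] F (reverse c ++ x ∷ [])
    ≡⟨ ∑-allCodes-reverse m (λ d → ∑[ x ∈ letters ] F (d ++ x ∷ [])) ⟩
  ∑[ d ∈ allCodes m ] ∑[ x ∈ letters ] F (d ++ x ∷ [])
    ≡⟨ sym (∑-allCodes-snoc m F) ⟩
  ∑[ c ∈ allCodes (suc m) ] F c ∎
  where open ≡-Reasoning

allCodes-length : ∀ m {c} → c ∈ allCodes m → length c ≡ m
allCodes-length zero (here refl) = refl
allCodes-length (suc m) c∈ with find (∈-concatMap⁻ (λ c → (O ∷ c) ∷ (M ∷ c) ∷ (P ∷ c) ∷ []) {xs = allCodes m} c∈)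
... | d , d∈ , here refl = cong suc (allCodes-length m d∈)
... | d , d∈ , there (here refl) = cong suc (allCodes-length m d∈)
... | d , d∈ , there (there (here refl)) = cong suc (allCodes-length m d∈)

canonical : Code → Bool
canonical c = lexLeq c (reverse c)

canonicalCodes : ℕ → List Code
canonicalCodes m = filterᵇ canonical (allCodes m)

canonicalCodes-length : ∀ m {c} → c ∈ canonicalCodes m → length c ≡ m
canonicalCodes-length m c∈ = allCodes-length m (proj₁ (filter-sound canonical (allCodes m) c∈))

mirror-involutive : ∀ c → map mirror (map mirror c) ≡ c
mirror-involutive [] = refl
mirror-involutive (O ∷ c) = cong (O ∷_) (mirror-involutive c)
mirror-involutive (M ∷ c) = cong (M ∷_) (mirror-involutive c)
mirror-involutive (P ∷ c) = cong (P ∷_) (mirror-involutive c)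

lexLeq-mirror : ∀ c d → length c ≡ length d → lexLeq (map mirror c) (map mirror d) ≡ lexLeq d c
lexLeq-mirror [] [] _ = refl
lexLeq-mirror (x ∷ c) (y ∷ d) len≡ = step x y (lexLeq-mirror c d (suc-injective len≡))
  where
  step : ∀ x y → lexLeq (map mirror c) (map mirror d) ≡ lexLeq d c →
         lexLeq (mirror x ∷ map mirror c) (mirror y ∷ map mirror d) ≡ lexLeq (y ∷ d) (x ∷ c)
  step O O rest = rest
  step O M rest = refl
  step O P rest = refl
  step M O rest = refl
  step M M rest = rest
  step M P rest = refl
  step P O rest = refl
  step P M rest = refl
  step P P rest = rest

∑-filter : ∀ {A : Set} (p : A → Bool) xs (f : A → ℕ) → ∑[ x ∈ filterᵇ p xs ] f x ≡ ∑[ x ∈ xs ] (if p x then f x else 0)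
∑-filter p [] f = refl
∑-filter p (x ∷ xs) f with p x
... | true = cong (f x +_) (∑-filter p xs f)
... | false = ∑-filter p xs f

-- For a reversal-invariant h, mirroring does not change the sum of h over the
-- canonical codes: c ↦ mirror c maps canonical codes to codes whose reversal is
-- canonical.
∑-canonical-mirror : ∀ m (h : Code → ℕ) → (∀ c → h (reverse c) ≡ h c) →
  ∑[ c ∈ canonicalCodes m ] h (map mirror c) ≡ ∑[ c ∈ canonicalCodes m ] h c
∑-canonical-mirror m h h-reverse = begin
  ∑[ c ∈ canonicalCodes m ] h (map mirror c)
    ≡⟨ ∑-filter canonical (allCodes m) (λ c → h (map mirror c)) ⟩
  ∑[ c ∈ allCodes m ] (if canonical c then h (map mirror c) else 0)
    ≡⟨ ∑-cong (allCodes m) (λ {c} _ → cong (λ d → if canonical d then h (map mirror c) else 0) (sym (mirror-involutive c))) ⟩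
  ∑[ c ∈ allCodes m ] mirrorCanonical (map mirror c)
    ≡⟨ ∑-allCodes-mirror m mirrorCanonical ⟩
  ∑[ c ∈ allCodes m ] mirrorCanonical c
    ≡⟨ ∑-cong (allCodes m) (λ {c} _ → cong (λ b → if b then h c else 0) (mirror-canonical c)) ⟩
  ∑[ c ∈ allCodes m ] reverseCanonical c
    ≡⟨ sym (∑-allCodes-reverse m reverseCanonical) ⟩
  ∑[ c ∈ allCodes m ] reverseCanonical (reverse c)
    ≡⟨ ∑-cong (allCodes m) (λ {c} _ →
         cong₂ (λ d n → if lexLeq d (reverse c) then n else 0) (reverse-involutive c) (h-reverse c)) ⟩
  ∑[ c ∈ allCodes m ] (if canonical c then h c else 0)
    ≡⟨ sym (∑-filter canonical (allCodes m) h) ⟩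
  ∑[ c ∈ canonicalCodes m ] h c ∎
  where
  open ≡-Reasoning
  mirrorCanonical reverseCanonical : Code → ℕ
  mirrorCanonical c = if canonical (map mirror c) then h c else 0
  reverseCanonical c = if lexLeq (reverse c) c then h c else 0
  mirror-canonical : ∀ c → canonical (map mirror c) ≡ lexLeq (reverse c) c
  mirror-canonical c = trans (cong (lexLeq (map mirror c)) (sym (reverse-map mirror c)))
                             (lexLeq-mirror c (reverse c) (sym (length-reverse c)))

∑-canonical-average : ∀ m (h : Code → ℕ) y → (∀ c → h (reverse c) ≡ h c) →
  (∀ c → length c ≡ m → h c + h (map mirror c) ≡ 2 * y) →
  ∑[ c ∈ canonicalCodes m ] h c ≡ length (canonicalCodes m) * y
∑-canonical-average m h y h-reverse h-mirror = *-cancelˡ-≡ _ _ 2 (begin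
  2 * ∑[ c ∈ S ] h c                                    ≡⟨ double (∑[ c ∈ S ] h c) ⟩
  ∑[ c ∈ S ] h c + ∑[ c ∈ S ] h c
    ≡⟨ cong (∑[ c ∈ S ] h c +_) (sym (∑-canonical-mirror m h h-reverse)) ⟩
  ∑[ c ∈ S ] h c + ∑[ c ∈ S ] h (map mirror c)          ≡⟨ sym (∑-+ S h (λ c → h (map mirror c))) ⟩
  ∑[ c ∈ S ] (h c + h (map mirror c))                   ≡⟨ ∑-cong S (λ c∈ → h-mirror _ (canonicalCodes-length m c∈)) ⟩
  ∑[ c ∈ S ] (2 * y)                                    ≡⟨ ∑-const S (2 * y) ⟩
  length S * (2 * y)                                    ≡⟨ swap (length S) y ⟩
  2 * (length S * y) ∎)
  where
  open ≡-Reasoning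
  S : List Code
  S = canonicalCodes m
  double : ∀ x → 2 * x ≡ x + x
  double = solve-∀
  swap : ∀ l y → l * (2 * y) ≡ 2 * (l * y)
  swap = solve-∀

theorem5p2 : (n : ℕ) → n ≥ 1 →
    3 * totalWiener n ≡ length (𝒢 n) * (25 * n ^ 3 + 60 * n ^ 2 ∸ 4 * n)
theorem5p2 zero ()
theorem5p2 (suc zero) _ = cong (λ w → 3 * (w + 0)) (wiener-hexagon [])
theorem5p2 (suc (suc m)) _ = begin
  3 * ∑[ G ∈ map (chain n) S ] wiener G       ≡⟨ cong (3 *_) (∑-map (chain n) S wiener) ⟩
  3 * ∑[ c ∈ S ] wiener (chain n c)           ≡⟨ cong (3 *_) (∑-cong S (λ {c} c∈ → wiener-chain m c (canonicalCodes-length m c∈))) ⟩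
  3 * ∑[ c ∈ S ] chainWiener n c              ≡⟨ sym (∑-* S 3 (chainWiener n)) ⟩
  ∑[ c ∈ S ] (3 * chainWiener n c)            ≡⟨ ∑-canonical-average m (λ c → 3 * chainWiener n c) (threeAverage m)
                                                   (λ c → cong (3 *_) (chainWiener-reverse n c)) (chainWiener-mirror m) ⟩
  length S * threeAverage m                   ≡⟨ cong₂ _*_ (sym (length-map (chain n) S)) (sym (cubic≡threeAverage m)) ⟩
  length (𝒢 n) * (25 * n ^ 3 + 60 * n ^ 2 ∸ 4 * n) ∎
  where
  open ≡-Reasoning
  n : ℕ
  n = suc (suc m)
  S : List Code
  S = canonicalCodes m
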